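{- Let $p$ be a prime, $m\ge1$, $q=p^m$, and for $i,j\in\mathbb{F}_p$ let $T_{ij}=|\{x\in\mathbb{F}_q^{*}: tr(x)=i,\ tr(x^{ -1})=j\}|$. Then for every $i\in\mathbb{F}_p^{*}$, $T_{0i}=T_{i0}=T_{10}=T_{01}$.
   Context: $\mathbb{F}_q$ is the finite field with $q=p^m$ elements and $tr(\gamma)=\gamma+\gamma^p+\cdots+\gamma^{p^{m-1}}\in\mathbb{F}_p$ is the absolute trace. -}

module Defs where

open import Level using (0ℓ)
open import Data.Nat using (ℕ; zero; suc; _^_)
open import Data.Fin using (Fin; zero; suc)
open import Data.Bool using (Bool; true; false; _∧_; not)
open import Data.Product using (Σ; _,_)
open import Relation.Nullary using (¬_; does)
open import Relation.Binary.PropositionalEquality using (_≡_)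
open import Relation.Binary.Definitions using (Decidable)
open import Algebra.Bundles using (CommutativeRing)

countFin : (n : ℕ) → (Fin n → Bool) → ℕ
countFin zero f = zero
countFin (suc n) f with f zero
... | true  = suc (countFin n (λ k → f (suc k)))
... | false = countFin n (λ k → f (suc k))

record FiniteField (p m : ℕ) : Set₁ where
  field
    cring : CommutativeRing 0ℓ 0ℓ
  open CommutativeRing cring public
  field
    _≟_      : Decidable _≈_
    1≉0      : ¬ (1# ≈ 0#)
    _⁻¹      : Carrier → Carrier
    inverseʳ : ∀ x → ¬ (x ≈ 0#) → (x * (x ⁻¹)) ≈ 1#
    enum     : Fin (p ^ m) → Carrier
    enum-inj : ∀ k l → enum k ≈ enum l → k ≡ l
    enum-sur : ∀ x → Σ (Fin (p ^ m)) (λ k → enum k ≈ x)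

  -- natural number n viewed in the field: n · 1  (i ∈ F_p for i < p)
  fromℕ : ℕ → Carrier
  fromℕ zero    = 0#
  fromℕ (suc n) = 1# + fromℕ n

  pow : Carrier → ℕ → Carrier
  pow x zero    = 1#
  pow x (suc n) = x * pow x n

  trAux : ℕ → Carrier → Carrier
  trAux zero    γ = 0#
  trAux (suc k) γ = pow γ (p ^ k) + trAux k γ

  tr : Carrier → Carrier
  tr γ = trAux m γ

  T : ℕ → ℕ → ℕ
  T i j = countFin (p ^ m) (λ k →
    _∧_ (not (does (enum k ≟ 0#)))
      (_∧_ (does (tr (enum k) ≟ fromℕ i))
                     (does (tr (enum k ⁻¹) ≟ fromℕ j))))

-- Inversion x ↦ x⁻¹ exchanges tr x and tr x⁻¹, so T i j = T j i.  Translation by 1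
-- permutes the q elements of the field, so q · 1 = 0 and the characteristic is p.  Then
-- p divides the inner binomial coefficients of (x + y) ^ p, Frobenius is additive, and
-- every c = i · 1 with 0 < i < p satisfies c ^ p = c and c ≠ 0.  Hence tr (c x) = c tr x,
-- and x ↦ c⁻¹ x maps {tr x = c, tr x⁻¹ = 0} bijectively onto {tr x = 1, tr x⁻¹ = 0}.
module Submission where

open import Data.Bool.Base using (Bool; true; false; if_then_else_)
open import Data.Fin.Base as Fin using (Fin; zero; suc; toℕ; inject₁)
open import Data.Fin.Permutation using (Permutation; _⟨$⟩ʳ_)
open import Data.Fin.Properties using (toℕ-fromℕ; inject₁ℕ<)
open import Data.Nat.Base as ℕ using (ℕ; zero; suc; _<_; _≤_)
open import Data.Nat.Combinatorics using (_C_; nCn≡1)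
open import Data.Nat.Coprimality using (prime⇒coprime; coprime-Bézout)
open import Data.Nat.Divisibility using (_∣_; divides)
open import Data.Nat.GCD using (module Bézout)
open import Data.Nat.Primality using (Prime)
open import Data.Nat.Properties using (+-0-commutativeMonoid; n∸n≡0)
open import Data.Product.Base using (_×_; _,_; proj₁; proj₂)
open import Function.Base using (_∘_)
open import Function.Bundles using (Inverse; _⇔_; mk⇔)
import Function.Consequences.Setoid as Consequences
import Function.Construct.Composition as Composition
import Function.Construct.Symmetry as Symmetry
open import Level using (0ℓ)
open import Relation.Binary.Bundles using (Setoid)
open import Relation.Binary.Definitions using (_Respects_)
open import Relation.Binary.PropositionalEquality as ≡ using (_≡_)
open import Relation.Nullary using (does; yes; no)
open import Relation.Nullary.Decidable using (does-⇔; ¬?; _×-dec_)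
open import Relation.Nullary.Negation using (contradiction)
open import Relation.Unary using (Pred; Decidable)
import Algebra.Properties.CommutativeMonoid.Sum as CommutativeMonoidSum
import Algebra.Properties.CommutativeSemigroup as CommutativeSemigroupProperties
import Algebra.Properties.CommutativeSemiring.Binomial as CommutativeSemiringBinomial
import Algebra.Properties.CommutativeSemiring.Exp as CommutativeSemiringExp
import Algebra.Properties.Monoid.Sum as MonoidSum
import Algebra.Properties.Ring as RingProperties

open import Defs

private module ℕ-Sum = CommutativeMonoidSum +-0-commutativeMonoid

countFin≡sum : ∀ n (f : Fin n → Bool) →
  countFin n f ≡ ℕ-Sum.sum (λ k → if f k then 1 else 0)
countFin≡sum zero    f = ≡.refl
countFin≡sum (suc n) f with f zero
... | true  = ≡.cong suc (countFin≡sum n (f ∘ suc))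
... | false = countFin≡sum n (f ∘ suc)

countFin-permute : ∀ {n} (f g : Fin n → Bool) (π : Permutation n n) →
  (∀ k → f k ≡ g (π ⟨$⟩ʳ k)) → countFin n f ≡ countFin n g
countFin-permute {n} f g π f≗g∘π = begin
  countFin n f                                      ≡⟨ countFin≡sum n f ⟩
  ℕ-Sum.sum (λ k → if f k then 1 else 0)            ≡⟨ ℕ-Sum.sum-cong-≗ (λ k → ≡.cong (if_then 1 else 0) (f≗g∘π k)) ⟩
  ℕ-Sum.sum (λ k → if g (π ⟨$⟩ʳ k) then 1 else 0)   ≡⟨ ℕ-Sum.∑-permute _ π ⟨
  ℕ-Sum.sum (λ k → if g k then 1 else 0)            ≡⟨ countFin≡sum n g ⟨
  countFin n g                                      ∎
  where open ≡.≡-Reasoning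

module _ {c ℓ} (S : Setoid c ℓ) where
  open Setoid S

  mkInverse : (f g : Carrier → Carrier) →
    (∀ {x y} → x ≈ y → f x ≈ f y) → (∀ {x y} → x ≈ y → g x ≈ g y) →
    (∀ y → f (g y) ≈ y) → (∀ x → g (f x) ≈ x) → Inverse S S
  mkInverse f g f-cong g-cong fg gf = record
    { to = f ; from = g ; to-cong = f-cong ; from-cong = g-cong
    ; inverse = strictlyInverseˡ⇒inverseˡ f-cong fg , strictlyInverseʳ⇒inverseʳ g-cong gf
    }
    where open Consequences S S

module Enumeration {c ℓ} {S : Setoid c ℓ} {n : ℕ}
                   (E : Inverse (≡.setoid (Fin n)) S) where
  open Setoid S
  open Inverse E using (to; strictlyInverseˡ)

  conjugate : Inverse S S → Permutation n n
  conjugate π = Composition.inverse E (Composition.inverse π (Symmetry.inverse E))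

  to-conjugate : (π : Inverse S S) → ∀ k → to (conjugate π ⟨$⟩ʳ k) ≈ Inverse.to π (to k)
  to-conjugate π k = strictlyInverseˡ (Inverse.to π (to k))

  countFin-transport :
    ∀ {p q} {P : Pred Carrier p} {Q : Pred Carrier q} (P? : Decidable P) (Q? : Decidable Q) →
    P Respects _≈_ → Q Respects _≈_ → (π : Inverse S S) →
    (∀ {x} → P x → Q (Inverse.to π x)) → (∀ {y} → Q y → P (Inverse.from π y)) →
    countFin n (λ k → does (P? (to k))) ≡ countFin n (λ k → does (Q? (to k)))
  countFin-transport {P = P} {Q} P? Q? P-resp Q-resp π P⇒Q Q⇒P =
    countFin-permute _ _ (conjugate π) λ k → does-⇔ (P⇔Q k) (P? (to k)) (Q? _)
    where
    P⇔Q : ∀ k → P (to k) ⇔ Q (to (conjugate π ⟨$⟩ʳ k))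
    P⇔Q k = mk⇔ (λ Px → Q-resp (sym (to-conjugate π k)) (P⇒Q Px))
                (λ Qy → P-resp (Inverse.strictlyInverseʳ π (to k))
                               (Q⇒P (Q-resp (to-conjugate π k) Qy)))

module BinomialCoefficient where
  open import Data.Nat.Base
  open import Data.Nat.Properties using (*-comm; <-irrefl; ≤-trans; *-zeroʳ; +-identityʳ; *-identityʳ)
  open import Data.Nat.Combinatorics using (nC1≡n; nCk+nC[k+1]≡[n+1]C[k+1])
  open import Data.Nat.Divisibility using (∣⇒≤)
  open import Data.Nat.Primality using (euclidsLemma)
  open import Data.Nat.Tactic.RingSolver using (solve-∀)
  open import Data.Sum.Base using (inj₁; inj₂)
  open import Relation.Binary.PropositionalEquality

  [k+1]*[n+1]C[k+1]≡[n+1]*nCk : ∀ n k → suc k * (suc n C suc k) ≡ suc n * (n C k)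
  [k+1]*[n+1]C[k+1]≡[n+1]*nCk zero    zero    = refl
  [k+1]*[n+1]C[k+1]≡[n+1]*nCk zero    (suc k) = *-zeroʳ (suc (suc k))
  [k+1]*[n+1]C[k+1]≡[n+1]*nCk (suc n) zero    =
    trans (+-identityʳ _) (trans (nC1≡n (suc (suc n))) (sym (*-identityʳ _)))
  [k+1]*[n+1]C[k+1]≡[n+1]*nCk (suc n) (suc k) = begin
    suc (suc k) * (suc (suc n) C suc (suc k))        ≡⟨ cong (suc (suc k) *_) (nCk+nC[k+1]≡[n+1]C[k+1] (suc n) (suc k)) ⟨
    suc (suc k) * (a + b)                            ≡⟨ expand k a b ⟩
    a + suc k * a + suc (suc k) * b                  ≡⟨ cong₂ (λ u v → a + u + v)
                                                          ([k+1]*[n+1]C[k+1]≡[n+1]*nCk n k)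
                                                          ([k+1]*[n+1]C[k+1]≡[n+1]*nCk n (suc k)) ⟩
    a + suc n * (n C k) + suc n * (n C suc k)        ≡⟨ collect a (suc n) (n C k) (n C suc k) ⟩
    a + suc n * (n C k + n C suc k)                  ≡⟨ cong (λ u → a + suc n * u) (nCk+nC[k+1]≡[n+1]C[k+1] n k) ⟩
    a + suc n * a                                    ≡⟨⟩
    suc (suc n) * a                                  ∎
    where
    open ≡-Reasoning
    a b : ℕ
    a = suc n C suc k
    b = suc n C suc (suc k)
    expand : ∀ k a b → suc (suc k) * (a + b) ≡ a + suc k * a + suc (suc k) * b
    expand = solve-∀
    collect : ∀ a m c d → a + m * c + m * d ≡ a + m * (c + d)
    collect = solve-∀

  p∣pC[k+1] : ∀ {n k} → Prime (suc n) → k < n → suc n ∣ suc n C suc k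
  p∣pC[k+1] {n} {k} p-prime k<n
    with euclidsLemma (suc k) (suc n C suc k) p-prime
           (divides (n C k) (trans ([k+1]*[n+1]C[k+1]≡[n+1]*nCk n k) (*-comm (suc n) (n C k))))
  ... | inj₂ p∣C   = p∣C
  ... | inj₁ p∣1+k = contradiction (≤-trans (s≤s k<n) (∣⇒≤ p∣1+k)) (<-irrefl refl)

open BinomialCoefficient using (p∣pC[k+1])

module FiniteFieldProperties {p m : ℕ} (F : FiniteField p m) where
  open FiniteField F
  open CommutativeSemiringExp commutativeSemiring
  open RingProperties ring using (+-identityʳ-unique)
  open CommutativeSemigroupProperties *-commutativeSemigroup using (x∙yz≈y∙xz)
  open import Algebra.Definitions.RawMonoid +-rawMonoid using () renaming (_×_ to _·_)
  open import Relation.Binary.Reasoning.Setoid setoid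
  private module Σ = CommutativeMonoidSum +-commutativeMonoid

  fromℕ-homo-+ : ∀ a b → fromℕ (a ℕ.+ b) ≈ fromℕ a + fromℕ b
  fromℕ-homo-+ zero    b = sym (+-identityˡ _)
  fromℕ-homo-+ (suc a) b = trans (+-congˡ (fromℕ-homo-+ a b)) (sym (+-assoc _ _ _))

  fromℕ-homo-* : ∀ a b → fromℕ (a ℕ.* b) ≈ fromℕ a * fromℕ b
  fromℕ-homo-* zero    b = sym (zeroˡ _)
  fromℕ-homo-* (suc a) b = begin
    fromℕ (b ℕ.+ a ℕ.* b)              ≈⟨ fromℕ-homo-+ b (a ℕ.* b) ⟩
    fromℕ b + fromℕ (a ℕ.* b)          ≈⟨ +-cong (sym (*-identityˡ _)) (fromℕ-homo-* a b) ⟩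
    1# * fromℕ b + fromℕ a * fromℕ b   ≈⟨ distribʳ _ _ _ ⟨
    (1# + fromℕ a) * fromℕ b           ∎

  fromℕ[a*k]≈0 : ∀ {k} → fromℕ k ≈ 0# → ∀ a → fromℕ (a ℕ.* k) ≈ 0#
  fromℕ[a*k]≈0 {k} fromℕk≈0 a = trans (fromℕ-homo-* a k) (trans (*-congˡ fromℕk≈0) (zeroʳ _))

  fromℕ[1+a]≉0 : ∀ {a} → fromℕ a ≈ 0# → fromℕ (suc a) ≉ 0#
  fromℕ[1+a]≉0 fromℕa≈0 1+fromℕa≈0 =
    1≉0 (trans (sym (trans (+-congˡ fromℕa≈0) (+-identityʳ 1#))) 1+fromℕa≈0)

  fromℕ-homo-^ : ∀ a n → fromℕ (a ℕ.^ n) ≈ fromℕ a ^ n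
  fromℕ-homo-^ a zero    = +-identityʳ 1#
  fromℕ-homo-^ a (suc n) = trans (fromℕ-homo-* a (a ℕ.^ n)) (*-congˡ (fromℕ-homo-^ a n))

  ·≈fromℕ* : ∀ n x → n · x ≈ fromℕ n * x
  ·≈fromℕ* zero    x = sym (zeroˡ x)
  ·≈fromℕ* (suc n) x = trans (+-cong (sym (*-identityˡ x)) (·≈fromℕ* n x)) (sym (distribʳ _ _ _))

  pow≡^ : ∀ x n → pow x n ≡ x ^ n
  pow≡^ x zero    = ≡.refl
  pow≡^ x (suc n) = ≡.cong (x *_) (pow≡^ x n)

  inverseˡ : ∀ x → x ≉ 0# → x ⁻¹ * x ≈ 1#
  inverseˡ x x≉0 = trans (*-comm _ _) (inverseʳ x x≉0)

  x≉0⇒x*y≈0⇒y≈0 : ∀ {x y} → x ≉ 0# → x * y ≈ 0# → y ≈ 0#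
  x≉0⇒x*y≈0⇒y≈0 {x} {y} x≉0 xy≈0 = begin
    y                  ≈⟨ *-identityˡ y ⟨
    1# * y             ≈⟨ *-congʳ (inverseˡ x x≉0) ⟨
    (x ⁻¹ * x) * y     ≈⟨ *-assoc _ _ _ ⟩
    x ⁻¹ * (x * y)     ≈⟨ *-congˡ xy≈0 ⟩
    x ⁻¹ * 0#          ≈⟨ zeroʳ _ ⟩
    0#                 ∎

  *-nonzero : ∀ {x y} → x ≉ 0# → y ≉ 0# → x * y ≉ 0#
  *-nonzero x≉0 y≉0 xy≈0 = y≉0 (x≉0⇒x*y≈0⇒y≈0 x≉0 xy≈0)

  x^n≈0⇒x≈0 : ∀ x n → x ^ n ≈ 0# → x ≈ 0#
  x^n≈0⇒x≈0 x zero    1≈0 = contradiction 1≈0 1≉0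
  x^n≈0⇒x≈0 x (suc n) xxⁿ≈0 with x ≟ 0#
  ... | yes x≈0 = x≈0
  ... | no  x≉0 = x^n≈0⇒x≈0 x n (x≉0⇒x*y≈0⇒y≈0 x≉0 xxⁿ≈0)

  ⁻¹-unique : ∀ {x y} → y ≉ 0# → x * y ≈ 1# → x ≈ y ⁻¹
  ⁻¹-unique {x} {y} y≉0 xy≈1 = begin
    x                  ≈⟨ *-identityʳ x ⟨
    x * 1#             ≈⟨ *-congˡ (inverseʳ y y≉0) ⟨
    x * (y * y ⁻¹)     ≈⟨ *-assoc _ _ _ ⟨
    (x * y) * y ⁻¹     ≈⟨ *-congʳ xy≈1 ⟩
    1# * y ⁻¹          ≈⟨ *-identityˡ _ ⟩
    y ⁻¹               ∎

  ⁻¹-nonzero : ∀ {x} → x ≉ 0# → x ⁻¹ ≉ 0#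
  ⁻¹-nonzero {x} x≉0 x⁻¹≈0 = 1≉0 (begin
    1#          ≈⟨ inverseʳ x x≉0 ⟨
    x * x ⁻¹    ≈⟨ *-congˡ x⁻¹≈0 ⟩
    x * 0#      ≈⟨ zeroʳ x ⟩
    0#          ∎)

  ≉0-resp-≈ : ∀ {x y} → x ≈ y → x ≉ 0# → y ≉ 0#
  ≉0-resp-≈ x≈y x≉0 y≈0 = x≉0 (trans x≈y y≈0)

  ⁻¹-cong : ∀ {x y} → x ≉ 0# → x ≈ y → x ⁻¹ ≈ y ⁻¹
  ⁻¹-cong {x} x≉0 x≈y =
    ⁻¹-unique (≉0-resp-≈ x≈y x≉0) (trans (*-congˡ (sym x≈y)) (inverseˡ x x≉0))

  ⁻¹-involutive : ∀ {x} → x ≉ 0# → x ⁻¹ ⁻¹ ≈ x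
  ⁻¹-involutive {x} x≉0 = sym (⁻¹-unique (⁻¹-nonzero x≉0) (inverseʳ x x≉0))

  ⁻¹-homo-* : ∀ {x y} → x ≉ 0# → y ≉ 0# → (x * y) ⁻¹ ≈ x ⁻¹ * y ⁻¹
  ⁻¹-homo-* {x} {y} x≉0 y≉0 = sym (⁻¹-unique (*-nonzero x≉0 y≉0) (begin
    (x ⁻¹ * y ⁻¹) * (x * y)    ≈⟨ *-assoc _ _ _ ⟩
    x ⁻¹ * (y ⁻¹ * (x * y))    ≈⟨ *-congˡ (x∙yz≈y∙xz _ _ _) ⟩
    x ⁻¹ * (x * (y ⁻¹ * y))    ≈⟨ *-congˡ (*-congˡ (inverseˡ y y≉0)) ⟩
    x ⁻¹ * (x * 1#)            ≈⟨ *-congˡ (*-identityʳ x) ⟩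
    x ⁻¹ * x                   ≈⟨ inverseˡ x x≉0 ⟩
    1#                         ∎))

  enumeration : Inverse (≡.setoid (Fin (p ℕ.^ m))) setoid
  enumeration = record
    { to        = enum
    ; from      = index
    ; to-cong   = λ { ≡.refl → refl }
    ; from-cong = λ {x} {y} x≈y → enum-inj _ _ (trans (enum-index x) (trans x≈y (sym (enum-index y))))
    ; inverse   = (λ { {x} ≡.refl → enum-index x }) , λ {x} {y} y≈ex → enum-inj _ _ (trans (enum-index y) y≈ex)
    }
    where
    index : Carrier → Fin (p ℕ.^ m)
    index x = proj₁ (enum-sur x)
    enum-index : ∀ x → enum (index x) ≈ x
    enum-index x = proj₂ (enum-sur x)

  open Enumeration enumeration using (conjugate; to-conjugate; countFin-transport)

  translation : Carrier → Inverse setoid setoid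
  translation a = mkInverse setoid (_+ a) (_- a) +-congʳ +-congʳ
    (λ y → trans (+-assoc _ _ _) (trans (+-congˡ (-‿inverseˡ a)) (+-identityʳ y)))
    (λ x → trans (+-assoc _ _ _) (trans (+-congˡ (-‿inverseʳ a)) (+-identityʳ x)))

  fromℕ[p^m]≈0 : fromℕ (p ℕ.^ m) ≈ 0#
  fromℕ[p^m]≈0 = +-identityʳ-unique (Σ.sum enum) _ (sym (begin
    Σ.sum enum                               ≈⟨ Σ.∑-permute enum (conjugate shift) ⟩
    Σ.sum (λ k → enum (conjugate shift ⟨$⟩ʳ k)) ≈⟨ Σ.sum-cong-≋ (to-conjugate shift) ⟩
    Σ.sum (λ k → enum k + 1#)                ≈⟨ Σ.∑-distrib-+ enum (λ _ → 1#) ⟩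
    Σ.sum enum + Σ.sum {p ℕ.^ m} (λ _ → 1#)  ≈⟨ +-congˡ (Σ.sum-replicate (p ℕ.^ m)) ⟩
    Σ.sum enum + (p ℕ.^ m) · 1#              ≈⟨ +-congˡ (trans (·≈fromℕ* (p ℕ.^ m) 1#) (*-identityʳ _)) ⟩
    Σ.sum enum + fromℕ (p ℕ.^ m)             ∎))
    where
    shift : Inverse setoid setoid
    shift = translation 1#

  fromℕ[p]≈0 : fromℕ p ≈ 0#
  fromℕ[p]≈0 = x^n≈0⇒x≈0 (fromℕ p) m (trans (sym (fromℕ-homo-^ p m)) fromℕ[p^m]≈0)

  1^n≈1 : ∀ n → 1# ^ n ≈ 1#
  1^n≈1 zero    = refl
  1^n≈1 (suc n) = trans (*-identityˡ _) (1^n≈1 n)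

  ^-fixed-iterate : ∀ {c} → c ^ p ≈ c → ∀ k → c ^ (p ℕ.^ k) ≈ c
  ^-fixed-iterate {c} c^p≈c zero    = *-identityʳ c
  ^-fixed-iterate {c} c^p≈c (suc k) = begin
    c ^ (p ℕ.* p ℕ.^ k)     ≈⟨ ^-assocʳ c p (p ℕ.^ k) ⟨
    (c ^ p) ^ (p ℕ.^ k)     ≈⟨ ^-congˡ (p ℕ.^ k) c^p≈c ⟩
    c ^ (p ℕ.^ k)           ≈⟨ ^-fixed-iterate c^p≈c k ⟩
    c                       ∎

  ⁻¹-fixed : ∀ {c} → c ≉ 0# → c ^ p ≈ c → c ⁻¹ ^ p ≈ c ⁻¹
  ⁻¹-fixed {c} c≉0 c^p≈c = ⁻¹-unique c≉0 (begin
    c ⁻¹ ^ p * c          ≈⟨ *-congˡ c^p≈c ⟨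
    c ⁻¹ ^ p * c ^ p      ≈⟨ ^-distrib-* (c ⁻¹) c p ⟨
    (c ⁻¹ * c) ^ p        ≈⟨ ^-congˡ p (inverseˡ c c≉0) ⟩
    1# ^ p                ≈⟨ 1^n≈1 p ⟩
    1#                    ∎)

  pow-congˡ : ∀ n {x y} → x ≈ y → pow x n ≈ pow y n
  pow-congˡ n {x} {y} x≈y rewrite pow≡^ x n | pow≡^ y n = ^-congˡ n x≈y

  trAux-cong : ∀ k {x y} → x ≈ y → trAux k x ≈ trAux k y
  trAux-cong zero    x≈y = refl
  trAux-cong (suc k) x≈y = +-cong (pow-congˡ (p ℕ.^ k) x≈y) (trAux-cong k x≈y)

  trAux-scale : ∀ {c} → c ^ p ≈ c → ∀ k x → trAux k (c * x) ≈ c * trAux k x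
  trAux-scale {c} c^p≈c zero    x = sym (zeroʳ c)
  trAux-scale {c} c^p≈c (suc k) x = begin
    pow (c * x) q + trAux k (c * x)      ≡⟨ ≡.cong (_+ trAux k (c * x)) (pow≡^ (c * x) q) ⟩
    (c * x) ^ q + trAux k (c * x)        ≈⟨ +-cong (^-distrib-* c x q) (trAux-scale c^p≈c k x) ⟩
    c ^ q * x ^ q + c * trAux k x        ≈⟨ +-congʳ (*-congʳ (^-fixed-iterate c^p≈c k)) ⟩
    c * x ^ q + c * trAux k x            ≈⟨ distribˡ c _ _ ⟨
    c * (x ^ q + trAux k x)              ≡⟨ ≡.cong (λ z → c * (z + trAux k x)) (pow≡^ x q) ⟨
    c * (pow x q + trAux k x)            ∎
    where
    q : ℕ
    q = p ℕ.^ k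

  tr-cong : ∀ {x y} → x ≈ y → tr x ≈ tr y
  tr-cong = trAux-cong m

  tr-scale : ∀ {c} → c ^ p ≈ c → ∀ x → tr (c * x) ≈ c * tr x
  tr-scale c^p≈c = trAux-scale c^p≈c m

  Traces : Carrier → Carrier → Pred Carrier 0ℓ
  Traces a b x = x ≉ 0# × tr x ≈ a × tr (x ⁻¹) ≈ b

  -- Unfolds to exactly the boolean that T counts, so T i j is a count of traces? (fromℕ i) (fromℕ j).
  traces? : ∀ a b → Decidable (Traces a b)
  traces? a b x = ¬? (x ≟ 0#) ×-dec tr x ≟ a ×-dec tr (x ⁻¹) ≟ b

  Traces-resp-≈ : ∀ {a b} → Traces a b Respects _≈_
  Traces-resp-≈ x≈y (x≉0 , trx≈a , trx⁻¹≈b) =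
    ≉0-resp-≈ x≈y x≉0 ,
    trans (tr-cong (sym x≈y)) trx≈a ,
    trans (tr-cong (⁻¹-cong (≉0-resp-≈ x≈y x≉0) (sym x≈y))) trx⁻¹≈b

  Traces-cong : ∀ {a a′ b b′ x} → a ≈ a′ → b ≈ b′ → Traces a b x → Traces a′ b′ x
  Traces-cong a≈a′ b≈b′ (x≉0 , trx≈a , trx⁻¹≈b) = x≉0 , trans trx≈a a≈a′ , trans trx⁻¹≈b b≈b′

  T-transport : ∀ {i j i′ j′} (π : Inverse setoid setoid) →
    (∀ {x} → Traces (fromℕ i) (fromℕ j) x → Traces (fromℕ i′) (fromℕ j′) (Inverse.to π x)) →
    (∀ {y} → Traces (fromℕ i′) (fromℕ j′) y → Traces (fromℕ i) (fromℕ j) (Inverse.from π y)) →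
    T i j ≡ T i′ j′
  T-transport π = countFin-transport (traces? _ _) (traces? _ _) Traces-resp-≈ Traces-resp-≈ π

  -- The record leaves 0 ⁻¹ unconstrained; sending 0 to 0 makes inversion an involution.
  inv₀ : Carrier → Carrier
  inv₀ x with x ≟ 0#
  ... | yes _ = 0#
  ... | no  _ = x ⁻¹

  inv₀-nonzero : ∀ {x} → x ≉ 0# → inv₀ x ≈ x ⁻¹
  inv₀-nonzero {x} x≉0 with x ≟ 0#
  ... | yes x≈0 = contradiction x≈0 x≉0
  ... | no  _   = refl

  inv₀-zero : ∀ {x} → x ≈ 0# → inv₀ x ≈ 0#
  inv₀-zero {x} x≈0 with x ≟ 0#
  ... | yes _   = refl
  ... | no  x≉0 = contradiction x≈0 x≉0

  inv₀-cong : ∀ {x y} → x ≈ y → inv₀ x ≈ inv₀ y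
  inv₀-cong {x} {y} x≈y with x ≟ 0#
  ... | yes x≈0 = sym (inv₀-zero (trans (sym x≈y) x≈0))
  ... | no  x≉0 = trans (⁻¹-cong x≉0 x≈y) (sym (inv₀-nonzero (≉0-resp-≈ x≈y x≉0)))

  inv₀-involutive : ∀ x → inv₀ (inv₀ x) ≈ x
  inv₀-involutive x with x ≟ 0#
  ... | yes x≈0 = trans (inv₀-zero refl) (sym x≈0)
  ... | no  x≉0 = trans (inv₀-nonzero (⁻¹-nonzero x≉0)) (⁻¹-involutive x≉0)

  inversion : Inverse setoid setoid
  inversion = mkInverse setoid inv₀ inv₀ inv₀-cong inv₀-cong inv₀-involutive inv₀-involutive

  Traces-inv₀ : ∀ {a b x} → Traces a b x → Traces b a (inv₀ x)
  Traces-inv₀ {x = x} (x≉0 , trx≈a , trx⁻¹≈b) =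
    inv₀x≉0 , trans (tr-cong inv₀x≈x⁻¹) trx⁻¹≈b , trans (tr-cong inv₀x⁻¹≈x) trx≈a
    where
    inv₀x≈x⁻¹ : inv₀ x ≈ x ⁻¹
    inv₀x≈x⁻¹ = inv₀-nonzero x≉0
    inv₀x≉0 : inv₀ x ≉ 0#
    inv₀x≉0 = ≉0-resp-≈ (sym inv₀x≈x⁻¹) (⁻¹-nonzero x≉0)
    inv₀x⁻¹≈x : inv₀ x ⁻¹ ≈ x
    inv₀x⁻¹≈x = trans (⁻¹-cong inv₀x≉0 inv₀x≈x⁻¹) (⁻¹-involutive x≉0)

  T-swap : ∀ i j → T i j ≡ T j i
  T-swap i j = T-transport {i} {j} {j} {i} inversion Traces-inv₀ Traces-inv₀

  scaling : ∀ {c} → c ≉ 0# → Inverse setoid setoid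
  scaling {c} c≉0 = mkInverse setoid (c *_) (c ⁻¹ *_) *-congˡ *-congˡ
    (λ y → trans (sym (*-assoc _ _ _)) (trans (*-congʳ (inverseʳ c c≉0)) (*-identityˡ y)))
    (λ x → trans (sym (*-assoc _ _ _)) (trans (*-congʳ (inverseˡ c c≉0)) (*-identityˡ x)))

  Traces-scale : ∀ {c a b x} → c ≉ 0# → c ^ p ≈ c → Traces a b x → Traces (c * a) (c ⁻¹ * b) (c * x)
  Traces-scale {c} {x = x} c≉0 c^p≈c (x≉0 , trx≈a , trx⁻¹≈b) =
    *-nonzero c≉0 x≉0 ,
    trans (tr-scale c^p≈c x) (*-congˡ trx≈a) ,
    trans (tr-cong (⁻¹-homo-* c≉0 x≉0))
          (trans (tr-scale (⁻¹-fixed c≉0 c^p≈c) (x ⁻¹)) (*-congˡ trx⁻¹≈b))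

module PrimeCharacteristic {n m : ℕ} (F : FiniteField (suc n) m) (p-prime : Prime (suc n)) where
  open FiniteField F
  open FiniteFieldProperties F
  open CommutativeSemiringExp commutativeSemiring using (_^_)
  open CommutativeSemiringBinomial commutativeSemiring using (theorem; binomialTerm)
  open import Relation.Binary.Reasoning.Setoid setoid

  private
    module Σ = MonoidSum +-monoid
    p : ℕ
    p = suc n

  fromℕ-nonzero : ∀ {k} → 0 < k → k < p → fromℕ k ≉ 0#
  fromℕ-nonzero {suc k} _ k<p fromℕk≈0 with coprime-Bézout (prime⇒coprime p-prime k<p)
  ... | Bézout.+- a b 1+b*k≡a*p = fromℕ[1+a]≉0 {b ℕ.* suc k} (fromℕ[a*k]≈0 fromℕk≈0 b)
          (trans (reflexive (≡.cong fromℕ 1+b*k≡a*p)) (fromℕ[a*k]≈0 fromℕ[p]≈0 a))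
  ... | Bézout.-+ a b 1+a*p≡b*k = fromℕ[1+a]≉0 {a ℕ.* p} (fromℕ[a*k]≈0 fromℕ[p]≈0 a)
          (trans (reflexive (≡.cong fromℕ 1+a*p≡b*k)) (fromℕ[a*k]≈0 fromℕk≈0 b))

  binomialTerm-vanishes : ∀ x y (i : Fin n) → binomialTerm x y p (suc (inject₁ i)) ≈ 0#
  binomialTerm-vanishes x y i with p∣pC[k+1] p-prime (inject₁ℕ< i)
  ... | divides a pC≡a*p = begin
    binomialTerm x y p (suc (inject₁ i))  ≈⟨ ·≈fromℕ* (p C suc j) z ⟩
    fromℕ (p C suc j) * z                 ≡⟨ ≡.cong (λ c → fromℕ c * z) pC≡a*p ⟩
    fromℕ (a ℕ.* p) * z                   ≈⟨ *-congʳ (fromℕ[a*k]≈0 fromℕ[p]≈0 a) ⟩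
    0# * z                                ≈⟨ zeroˡ z ⟩
    0#                                    ∎
    where
    j : ℕ
    j = toℕ (inject₁ i)
    z : Carrier
    z = x ^ suc j * y ^ (p ℕ.∸ suc j)

  frobenius : ∀ x y → (x + y) ^ p ≈ x ^ p + y ^ p
  frobenius x y = begin
    (x + y) ^ p                                              ≈⟨ theorem p x y ⟩
    t Fin.zero + Σ.sum (t ∘ suc)                             ≈⟨ +-congˡ (Σ.sum-init-last (t ∘ suc)) ⟩
    t Fin.zero + (Σ.sum (t ∘ suc ∘ inject₁) + t (suc last))  ≈⟨ +-cong first (+-cong middle (final (toℕ-fromℕ n))) ⟩
    y ^ p + (0# + x ^ p)                                     ≈⟨ +-congˡ (+-identityˡ _) ⟩
    y ^ p + x ^ p                                            ≈⟨ +-comm _ _ ⟩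
    x ^ p + y ^ p                                            ∎
    where
    t : Fin (suc p) → Carrier
    t = binomialTerm x y p
    last : Fin p
    last = Fin.fromℕ n
    first : t Fin.zero ≈ y ^ p
    first = trans (+-identityʳ _) (*-identityˡ _)
    middle : Σ.sum (t ∘ suc ∘ inject₁) ≈ 0#
    middle = trans (Σ.sum-cong-≋ (binomialTerm-vanishes x y)) (Σ.sum-replicate-zero n)
    final : toℕ last ≡ n → t (suc last) ≈ x ^ p
    final eq rewrite eq | nCn≡1 p | n∸n≡0 p = trans (+-identityʳ _) (*-identityʳ _)

  fromℕ^p≈fromℕ : ∀ k → fromℕ k ^ p ≈ fromℕ k
  fromℕ^p≈fromℕ zero    = zeroˡ _
  fromℕ^p≈fromℕ (suc k) = begin
    (1# + fromℕ k) ^ p       ≈⟨ frobenius 1# (fromℕ k) ⟩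
    1# ^ p + fromℕ k ^ p     ≈⟨ +-cong (1^n≈1 p) (fromℕ^p≈fromℕ k) ⟩
    1# + fromℕ k             ∎

  T-scale : ∀ {i} → 0 < i → i < p → T i 0 ≡ T 1 0
  T-scale {i} 0<i i<p = T-transport {i} {0} {1} {0} (Symmetry.inverse (scaling c≉0))
    (λ traces → Traces-cong (trans (inverseˡ c c≉0) (sym (+-identityʳ 1#))) (zeroʳ _)
                  (Traces-scale (⁻¹-nonzero c≉0) (⁻¹-fixed c≉0 c^p≈c) traces))
    (λ traces → Traces-cong (trans (*-congˡ (+-identityʳ 1#)) (*-identityʳ c)) (zeroʳ _)
                  (Traces-scale c≉0 c^p≈c traces))
    where
    c : Carrier
    c = fromℕ i
    c≉0 : c ≉ 0#
    c≉0 = fromℕ-nonzero 0<i i<p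
    c^p≈c : c ^ p ≈ c
    c^p≈c = fromℕ^p≈fromℕ i

corollary1 : (p m : ℕ) → Prime p → 1 ≤ m → (F : FiniteField p m) →
    (i : ℕ) → 1 ≤ i → i < p →
      (FiniteField.T F 0 i ≡ FiniteField.T F i 0)
      × (FiniteField.T F i 0 ≡ FiniteField.T F 1 0)
      × (FiniteField.T F 1 0 ≡ FiniteField.T F 0 1)
corollary1 zero    m _       _ F i _   ()
corollary1 (suc n) m p-prime _ F i 0<i i<p = T-swap 0 i , T-scale 0<i i<p , T-swap 1 0
  where
  open FiniteFieldProperties F
  open PrimeCharacteristic F p-prime
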